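{- Let $A, B$ be types in a univalent universe $\mathcal{U}$ and let $f : A \to B$ be such that $\mathsf{ishadj}\, f$ is inhabited. Then there is an equivalence of types \[ \mathsf{adj}\, f \simeq \prod_{x : A} (\mathsf{refl}_x = \mathsf{refl}_x). \]
   Context: Work in homotopy type theory (with univalence and function extensionality). For $f : A \to B$, write $f[p] : fx = fy$ for $\mathsf{ap}_f\, p$ where $p : x = y$. $f \sim g$ denotes the type of homotopies $\prod_x fx = gx$. For a homotopy $H : f \sim g$ with $f,g : A \to B$ and $h : C \to A$, $H_h : fh \sim gh$ is $\lambda c.\, H_{hc}$; for $k : B \to C$, $k[H] : kf \sim kg$ is $\lambda a.\, k[H_a]$. Define $\mathsf{ishadj}\, f :\equiv \sum_{g : B \to A} \sum_{\eta : gf \sim \mathsf{id}_A} \sum_{\varepsilon : fg \sim \mathsf{id}_B} (f[\eta] \sim \varepsilon_f)$ and $\mathsf{adj}\, f :\equiv \sum_{g : B \to A} \sum_{\eta : gf \sim \mathsf{id}_A} \sum_{\varepsilon : fg \sim \mathsf{id}_B} (f[\eta] \sim \varepsilon_f) \times (\eta_g \sim g[\varepsilon])$. -}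

{-# OPTIONS --without-K #-}
module Defs where

open import Level using (Level; _⊔_; suc)
open import Data.Product using (Σ; Σ-syntax; _×_; _,_)
open import Relation.Binary.PropositionalEquality using (_≡_; refl; cong)

ap : ∀ {a b} {A : Set a} {B : Set b} (f : A → B) {x y : A} → x ≡ y → f x ≡ f y
ap f p = cong f p

infix 4 _∼_
_∼_ : ∀ {a b} {A : Set a} {P : A → Set b} (f g : (x : A) → P x) → Set (a ⊔ b)
f ∼ g = ∀ x → f x ≡ g x

idf : ∀ {a} (A : Set a) → A → A
idf A x = x

_∘_ : ∀ {a b c} {A : Set a} {B : Set b} {C : Set c} → (B → C) → (A → B) → A → C
(g ∘ f) x = g (f x)

isEquiv : ∀ {a b} {A : Set a} {B : Set b} → (A → B) → Set (a ⊔ b)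
isEquiv {A = A} {B = B} f =
  (Σ[ g ∈ (B → A) ] (g ∘ f) ∼ idf A) × (Σ[ h ∈ (B → A) ] (f ∘ h) ∼ idf B)

infix 4 _≃_
_≃_ : ∀ {a b} (A : Set a) (B : Set b) → Set (a ⊔ b)
A ≃ B = Σ[ e ∈ (A → B) ] isEquiv e

happly : ∀ {a b} {A : Set a} {P : A → Set b} {f g : (x : A) → P x} → f ≡ g → f ∼ g
happly refl x = refl

FunExt : (a b : Level) → Set (suc (a ⊔ b))
FunExt a b = ∀ {A : Set a} {P : A → Set b} (f g : (x : A) → P x) → isEquiv (happly {f = f} {g = g})

idEquiv : ∀ {ℓ} (A : Set ℓ) → A ≃ A
idEquiv A = idf A , ((idf A , λ x → refl) , (idf A , λ x → refl))

idtoeqv : ∀ {ℓ} {A B : Set ℓ} → A ≡ B → A ≃ B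
idtoeqv {A = A} refl = idEquiv A

Univalence : (ℓ : Level) → Set (suc ℓ)
Univalence ℓ = (A B : Set ℓ) → isEquiv (idtoeqv {A = A} {B = B})

ishadj : ∀ {a b} {A : Set a} {B : Set b} → (A → B) → Set (a ⊔ b)
ishadj {A = A} {B = B} f =
  Σ[ g ∈ (B → A) ] Σ[ η ∈ (g ∘ f) ∼ idf A ] Σ[ ε ∈ (f ∘ g) ∼ idf B ]
    ((λ x → ap f (η x)) ∼ (λ x → ε (f x)))

adj : ∀ {a b} {A : Set a} {B : Set b} → (A → B) → Set (a ⊔ b)
adj {A = A} {B = B} f =
  Σ[ g ∈ (B → A) ] Σ[ η ∈ (g ∘ f) ∼ idf A ] Σ[ ε ∈ (f ∘ g) ∼ idf B ]
    (((λ x → ap f (η x)) ∼ (λ x → ε (f x))) × ((λ y → η (g y)) ∼ (λ y → ap g (ε y))))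

{-# OPTIONS --without-K #-}
module Submission where

-- By univalence it suffices to treat f = id.  Then the pair (g , η) ranges over
-- Σ g, g ∼ id and the pair (ε , f[η] ∼ ε_f) over Σ ε, (λ x → refl) ∼ ε; both
-- are contractible by function extensionality, with centres (id , refl) and
-- (refl , refl).  Contracting them leaves the coherence η_g ∼ g[ε] at these
-- centres, which is Π x, refl_x = refl_x.

open import Defs
open import Level using (Level)
open import Data.Product using (Σ; Σ-syntax; _×_; _,_; proj₁; proj₂)
open import Function.Bundles using (_↔_; Inverse; mk↔ₛ′)
open import Function.Related.Propositional using (bijection; module EquationalReasoning)
open import Function.Related.TypeIsomorphisms using (Σ-assoc)
open import Relation.Binary.PropositionalEquality using (_≡_; refl; sym; trans; cong; subst)
open import Relation.Binary.PropositionalEquality.Properties using (trans-symˡ)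

private
  variable
    a b ℓ : Level

↔⇒≃ : {A : Set a} {B : Set b} → A ↔ B → A ≃ B
↔⇒≃ A↔B = to , ((from , strictlyInverseʳ) , (from , strictlyInverseˡ))
  where open Inverse A↔B

isContr : Set a → Set a
isContr X = Σ[ c ∈ X ] (∀ x → c ≡ x)

Σ-contractible-base : {X : Set a} (P : X → Set b) (X-contr : isContr X) →
                      Σ X P ↔ P (proj₁ X-contr)
Σ-contractible-base P (c , contraction) =
  mk↔ₛ′ (λ (x , p) → subst P (sym (path x)) p) (c ,_)
        (λ q → cong (λ r → subst P (sym r) q) (trans-symˡ (contraction c)))
        (λ (x , p) → pair-along (path x) p)
  where
  -- normalised so that path c is refl up to trans-symˡ
  path : ∀ x → c ≡ x
  path x = trans (sym (contraction c)) (contraction x)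

  pair-along : ∀ {x} (r : c ≡ x) (p : P x) → (c , subst P (sym r) p) ≡ (x , p)
  pair-along refl p = refl

module _ (fe : FunExt a b) {A : Set a} {P : A → Set b} where

  funext : {f g : (x : A) → P x} → f ∼ g → f ≡ g
  funext {f} {g} = proj₁ (proj₂ (fe f g))

  happly-funext : {f g : (x : A) → P x} (h : f ∼ g) → happly (funext h) ≡ h
  happly-funext {f} {g} = proj₂ (proj₂ (fe f g))

  homotopies-from-contr : (f : (x : A) → P x) → isContr (Σ[ g ∈ ((x : A) → P x) ] f ∼ g)
  homotopies-from-contr f = (f , λ x → refl) , λ (g , h) →
    trans (along (funext h)) (cong (g ,_) (happly-funext h))
    where
    along : ∀ {g} (p : f ≡ g) → _≡_ {A = Σ _ (f ∼_)} (f , λ x → refl) (g , happly p)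
    along refl = refl

  homotopies-to-contr : (f : (x : A) → P x) → isContr (Σ[ g ∈ ((x : A) → P x) ] g ∼ f)
  homotopies-to-contr f = (f , λ x → refl) , λ (g , h) →
    trans (along (funext h)) (cong (g ,_) (happly-funext h))
    where
    along : ∀ {g} (p : g ≡ f) → _≡_ {A = Σ _ (_∼ f)} (f , λ x → refl) (g , happly p)
    along refl = refl

equiv-induction : ∀ {ℓ′} → Univalence ℓ → {A : Set ℓ} (P : {B : Set ℓ} → (A → B) → Set ℓ′) →
                  P (idf A) → {B : Set ℓ} (e : A ≃ B) → P (proj₁ e)
equiv-induction ua {A} P P-id {B} e =
  subst (λ e → P (proj₁ e)) (proj₂ (proj₂ (ua A B)) e) (along (proj₁ (proj₂ (ua A B)) e))
  where
  along : ∀ {C} (p : A ≡ C) → P (proj₁ (idtoeqv p))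
  along refl = P-id

adj-id↔ : FunExt ℓ ℓ → (A : Set ℓ) → adj (idf A) ↔ ((x : A) → refl {x = x} ≡ refl {x = x})
adj-id↔ fe A =
  begin
    adj (idf A)
  ↔⟨ Σ-assoc ⟨
    (Σ[ (g , η) ∈ Σ[ g ∈ (A → A) ] g ∼ idf A ] Σ[ ε ∈ g ∼ idf A ]
      ((λ x → ap (idf A) (η x)) ∼ ε) × ((λ y → η (g y)) ∼ (λ y → ap g (ε y))))
  ↔⟨ Σ-contractible-base _ (homotopies-to-contr fe (idf A)) ⟩
    (Σ[ ε ∈ idf A ∼ idf A ] ((λ x → refl) ∼ ε) × ((λ y → refl) ∼ (λ y → ap (idf A) (ε y))))
  ↔⟨ Σ-assoc ⟨
    (Σ[ (ε , _) ∈ Σ[ ε ∈ idf A ∼ idf A ] (λ x → refl) ∼ ε ] (λ y → refl) ∼ (λ y → ap (idf A) (ε y)))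
  ↔⟨ Σ-contractible-base _ (homotopies-from-contr fe (λ x → refl)) ⟩
    ((x : A) → refl {x = x} ≡ refl {x = x})
  ∎
  where open EquationalReasoning {k = bijection}

theorem2p4 : ∀ {ℓ : Level} → Univalence ℓ → FunExt ℓ ℓ →
    {A B : Set ℓ} (f : A → B) → ishadj f →
    adj f ≃ ((x : A) → refl {x = x} ≡ refl {x = x})
theorem2p4 ua fe {A} f (g , η , ε , _) =
  equiv-induction ua (λ f → adj f ≃ ((x : A) → refl {x = x} ≡ refl {x = x}))
    (↔⇒≃ (adj-id↔ fe A)) (f , ((g , η) , (g , ε)))
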